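{- Let $p=2$, let $R=\mathbb{F}_2[x_1,\dots,x_N]/(x_1^2-x_1,\dots,x_N^2-x_N)$, and let $1\le k\le N$. Let $\{f_I\}$ be a family of ${N\choose k}$ elements of $R$ indexed by the $k$-subsets $I\subseteq[N]$, such that for every such $I$, $\deg\big(f_I-\prod_{i\in I}x_i\big)\le k-1$. Let $J$ be the ideal of $R$ generated by the $f_I$. Then $$\dim_{\mathbb{F}_2}(R/J)\le\sum_{j=0}^{k-1}{N\choose j}.$$
   Context: Elements of $R$ are identified with their unique multilinear representatives, and degree means the degree of that representative. -}

module Defs where

open import Data.Bool using (Bool; true; false; _∧_; _xor_; if_then_else_)
open import Data.Nat using (ℕ; zero; suc; _≤_; _∸_)
open import Data.Nat.Combinatorics using (_C_)
open import Data.Fin using (Fin)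
open import Data.Fin.Subset using (Subset; _∪_; ∣_∣)
open import Data.Vec using (Vec; []; _∷_)
open import Data.Vec.Properties using (≡-dec)
open import Data.List using (List; []; _∷_; _++_; map; concatMap; foldr; upTo)
open import Data.Nat.ListAction using (sum)
open import Data.Product using (∃)
open import Relation.Nullary.Decidable using (⌊_⌋)
open import Relation.Binary.PropositionalEquality using (_≡_)
import Data.Bool.Properties as BP

allSubs : (n : ℕ) → List (Subset n)
allSubs zero = [] ∷ []
allSubs (suc n) = map (false ∷_) (allSubs n) ++ map (true ∷_) (allSubs n)

_≟S_ : ∀ {n} (S T : Subset n) → Bool
S ≟S T = ⌊ ≡-dec BP._≟_ S T ⌋

-- R = F₂[x₁..x_N]/(x_i² - x_i), an element is identified with its unique
-- multilinear representative, i.e. its coefficient function on monomials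
-- x_S = ∏_{i∈S} x_i (S ⊆ [N]); F₂ is Bool with xor/∧.
R : ℕ → Set
R N = Subset N → Bool

xorSum : List Bool → Bool
xorSum = foldr _xor_ false

0R : ∀ {N} → R N
0R _ = false

_+R_ : ∀ {N} → R N → R N → R N
(f +R g) S = f S xor g S

-- characteristic 2: subtraction is addition
_-R_ : ∀ {N} → R N → R N → R N
f -R g = f +R g

-- x_S x_T = x_{S ∪ T} since x_i² = x_i
_*R_ : ∀ {N} → R N → R N → R N
_*R_ {N} f g U =
  xorSum (concatMap (λ S → map (λ T → (f S ∧ g T) ∧ ((S ∪ T) ≟S U)) (allSubs N)) (allSubs N))

_·R_ : ∀ {N} → Bool → R N → R N
(c ·R f) S = c ∧ f S

mono : ∀ {N} → Subset N → R N
mono I S = S ≟S I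

_≈R_ : ∀ {N} → R N → R N → Set
f ≈R g = ∀ S → f S ≡ g S

-- deg f ≤ d (degree of the multilinear representative; deg 0 = -∞)
DegLe : ∀ {N} → R N → ℕ → Set
DegLe f d = ∀ S → f S ≡ true → ∣ S ∣ ≤ d

data InIdeal {N : ℕ} (k : ℕ) (f : Subset N → R N) : R N → Set where
  gen  : ∀ I → ∣ I ∣ ≡ k → InIdeal k f (f I)
  zro  : InIdeal k f 0R
  add  : ∀ {a b} → InIdeal k f a → InIdeal k f b → InIdeal k f (a +R b)
  mul  : ∀ r {a} → InIdeal k f a → InIdeal k f (r *R a)
  resp : ∀ {a b} → a ≈R b → InIdeal k f a → InIdeal k f b

linComb : ∀ {N} (m : ℕ) → (Fin m → Bool) → (Fin m → R N) → R N
linComb zero c g = 0R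
linComb (suc m) c g = (c Fin.zero ·R g Fin.zero) +R linComb m (λ i → c (Fin.suc i)) (λ i → g (Fin.suc i))

-- dim_{F₂}(R/J) ≤ m : R/J is spanned over F₂ by (the classes of) m elements,
-- i.e. every r ∈ R is congruent mod J to an F₂-combination of g₁..g_m.
QuotDimLe : ∀ {N} (J : R N → Set) → ℕ → Set
QuotDimLe {N} J m = ∃ λ (g : Fin m → R N) →
  ∀ (r : R N) → ∃ λ (c : Fin m → Bool) → J (r -R linComb m c g)

binomSum : ℕ → ℕ → ℕ
binomSum N k = sum (map (N C_) (upTo k))

module Submission where

-- Put K = k ≥ 1 and let g be the family of all monomials x_S
-- with |S| < K; there are exactly Σ_{j<K} (N choose j) of them.  Call r
-- "reducible" if r is congruent modulo J to an F₂-combination of g.  Reducible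
-- elements are closed under addition, so since every r is the sum of the
-- monomials in its support it suffices to show every monomial x_S reducible.
-- This goes by strong induction on |S|.  If |S| < K then x_S is itself in g.
-- Otherwise split S = A ∪ I disjointly with |I| = K; then
--     x_S = x_A x_I = x_A f_I + x_A (f_I - x_I),
-- the first summand lies in J, and the second has degree ≤ |A| + (K - 1) < |S|,
-- so it is reducible by the induction hypothesis.

open import Defs
open import Data.Nat using (ℕ; _≤_; _∸_)
open import Data.Fin.Subset using (Subset; ∣_∣)
open import Relation.Binary.PropositionalEquality using (_≡_)

open import Algebra.Bundles using (CommutativeRing; CommutativeMonoid)
open import Data.Bool using (Bool; true; false; _∧_; _xor_)
open import Data.Bool.Properties as BP
  using (xor-assoc; xor-same; xor-identityʳ; ∧-distribˡ-xor; ∧-distribʳ-xor; ∧-zeroʳ;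
         ∧-comm; T-≡; xor-∧-commutativeRing)
open import Data.Nat using (zero; suc; _+_; _<_; z≤n; s≤s; _<?_)
open import Data.Nat.Properties using (+-comm; +-suc; ≤-trans; ≤-<-trans; ≤-reflexive; +-monoʳ-≤; +-monoʳ-<; n<1+n; n≤1+n; +-mono-≤; ≮⇒≥)
open import Data.Nat.Combinatorics using (_C_; nCk+nC[k+1]≡[n+1]C[k+1])
open import Data.Nat.Induction using (<-rec)
open import Data.Nat.ListAction using (sum)
open import Data.Fin using (Fin)
open import Data.Fin.Subset using (_∪_)
open import Data.Vec using (_∷_; [])
open import Data.Vec.Properties using (≡-dec)
open import Data.List using (List; []; _∷_; _++_; map; concatMap; upTo; length; lookup)
open import Data.List.Properties using (length-map; length-++; map-++; map-cong; map-∘)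
open import Data.List.Membership.Propositional using (_∈_)
open import Data.List.Membership.Propositional.Properties using (∈-map⁺; ∈-++⁺ˡ; ∈-++⁺ʳ; ∈-concat⁺′; ∈-upTo⁺)
open import Data.List.Relation.Unary.Any using (here; index)
open import Data.List.Relation.Unary.Any.Properties using (lookup-index)
open import Data.Product using (∃; ∃₂; _,_; _×_)
open import Function using (_∘_; Equivalence)
open import Relation.Nullary using (yes; no)
open import Relation.Nullary.Decidable using (⌊_⌋; isYes≗does; dec-true; dec-false; toWitness)
open import Relation.Binary.PropositionalEquality using (refl; sym; trans; cong; cong₂; subst; module ≡-Reasoning)
open import Relation.Binary.PropositionalEquality.Properties using (subst-sym-subst)
open import Algebra.Properties.CommutativeSemigroup
  (CommutativeMonoid.commutativeSemigroup (CommutativeRing.+-commutativeMonoid xor-∧-commutativeRing))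
  using (interchange)

xor-cancel : ∀ a b → a xor (a xor b) ≡ b
xor-cancel a b = trans (sym (xor-assoc a a b)) (cong (_xor b) (xor-same a))

∧-true : ∀ {a b} → a ∧ b ≡ true → a ≡ true × b ≡ true
∧-true {true} {true} _ = refl , refl

⊕-sum : {A : Set} → (A → Bool) → List A → Bool
⊕-sum e xs = xorSum (map e xs)

module _ {A : Set} where

  ⊕-sum-cong : ∀ {e e′ : A → Bool} (xs : List A) → (∀ x → e x ≡ e′ x) → ⊕-sum e xs ≡ ⊕-sum e′ xs
  ⊕-sum-cong xs e≗e′ = cong xorSum (map-cong e≗e′ xs)

  ⊕-sum-zero : ∀ {e : A → Bool} (xs : List A) → (∀ x → e x ≡ false) → ⊕-sum e xs ≡ false
  ⊕-sum-zero []       e≡0 = refl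
  ⊕-sum-zero (x ∷ xs) e≡0 = cong₂ _xor_ (e≡0 x) (⊕-sum-zero xs e≡0)

  ⊕-sum-xor : ∀ (e e′ : A → Bool) (xs : List A) →
              ⊕-sum (λ x → e x xor e′ x) xs ≡ ⊕-sum e xs xor ⊕-sum e′ xs
  ⊕-sum-xor e e′ []       = refl
  ⊕-sum-xor e e′ (x ∷ xs) =
    trans (cong ((e x xor e′ x) xor_) (⊕-sum-xor e e′ xs)) (interchange (e x) (e′ x) _ _)

  ⊕-sum-scale : ∀ b (e : A → Bool) (xs : List A) → ⊕-sum (λ x → b ∧ e x) xs ≡ b ∧ ⊕-sum e xs
  ⊕-sum-scale b e []       = sym (∧-zeroʳ b)
  ⊕-sum-scale b e (x ∷ xs) =
    trans (cong ((b ∧ e x) xor_) (⊕-sum-scale b e xs)) (sym (∧-distribˡ-xor b (e x) _))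

  ⊕-sum-true : ∀ (e : A → Bool) (xs : List A) → ⊕-sum e xs ≡ true → ∃ λ x → e x ≡ true
  ⊕-sum-true e []       ()
  ⊕-sum-true e (x ∷ xs) sum≡1 with e x in ex
  ... | true  = x , ex
  ... | false = ⊕-sum-true e xs sum≡1

xorSum-++ : ∀ (bs cs : List Bool) → xorSum (bs ++ cs) ≡ xorSum bs xor xorSum cs
xorSum-++ []       cs = refl
xorSum-++ (b ∷ bs) cs = trans (cong (b xor_) (xorSum-++ bs cs)) (sym (xor-assoc b _ _))

⊕-sum-++ : ∀ {A : Set} (e : A → Bool) (xs ys : List A) → ⊕-sum e (xs ++ ys) ≡ ⊕-sum e xs xor ⊕-sum e ys
⊕-sum-++ e xs ys = trans (cong xorSum (map-++ e xs ys)) (xorSum-++ (map e xs) (map e ys))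

⊕-sum-map : ∀ {A B : Set} (e : B → Bool) (h : A → B) (xs : List A) → ⊕-sum e (map h xs) ≡ ⊕-sum (e ∘ h) xs
⊕-sum-map e h xs = cong xorSum (sym (map-∘ xs))

xorSum-concatMap : ∀ {A : Set} (F : A → List Bool) (xs : List A) →
                   xorSum (concatMap F xs) ≡ ⊕-sum (xorSum ∘ F) xs
xorSum-concatMap F []       = refl
xorSum-concatMap F (x ∷ xs) =
  trans (xorSum-++ (F x) (concatMap F xs)) (cong (xorSum (F x) xor_) (xorSum-concatMap F xs))

≟S-cons : ∀ {n} x y (S T : Subset n) → ((x ∷ S) ≟S (y ∷ T)) ≡ ⌊ x BP.≟ y ⌋ ∧ (S ≟S T)
≟S-cons x y S T =
  trans (isYes≗does _) (cong₂ _∧_ (sym (isYes≗does (x BP.≟ y))) (sym (isYes≗does (≡-dec BP._≟_ S T))))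

≟S-refl : ∀ {n} (S : Subset n) → (S ≟S S) ≡ true
≟S-refl S = trans (isYes≗does _) (dec-true (≡-dec BP._≟_ S S) refl)

≟S-sound : ∀ {n} {S T : Subset n} → (S ≟S T) ≡ true → S ≡ T
≟S-sound S≟T = toWitness (Equivalence.from T-≡ S≟T)

≟S-sym : ∀ {n} (S T : Subset n) → (S ≟S T) ≡ (T ≟S S)
≟S-sym S T with ≡-dec BP._≟_ S T
... | yes refl = sym (≟S-refl S)
... | no S≢T   = sym (trans (isYes≗does _) (dec-false (≡-dec BP._≟_ T S) (S≢T ∘ sym)))

-- Every subset occurs exactly once in allSubs, so a delta picks out one term.
⊕-sum-δ : ∀ n (A : Subset n) (c : Subset n → Bool) → ⊕-sum (λ S → (S ≟S A) ∧ c S) (allSubs n) ≡ c A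
⊕-sum-δ zero    []      c = xor-identityʳ (c [])
⊕-sum-δ (suc n) (a ∷ A) c = begin
  ⊕-sum δc (map (false ∷_) subs ++ map (true ∷_) subs)
    ≡⟨ ⊕-sum-++ δc (map (false ∷_) subs) (map (true ∷_) subs) ⟩
  ⊕-sum δc (map (false ∷_) subs) xor ⊕-sum δc (map (true ∷_) subs)
    ≡⟨ cong₂ _xor_ (half false) (half true) ⟩
  (⌊ false BP.≟ a ⌋ ∧ c (false ∷ A)) xor (⌊ true BP.≟ a ⌋ ∧ c (true ∷ A))
    ≡⟨ by-head a ⟩
  c (a ∷ A) ∎
  where
  open ≡-Reasoning
  subs = allSubs n
  δc : Subset (suc n) → Bool
  δc S = (S ≟S (a ∷ A)) ∧ c S

  half : ∀ x → ⊕-sum δc (map (x ∷_) subs) ≡ ⌊ x BP.≟ a ⌋ ∧ c (x ∷ A)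
  half x = begin
    ⊕-sum δc (map (x ∷_) subs)
      ≡⟨ ⊕-sum-map δc (x ∷_) subs ⟩
    ⊕-sum (λ S → ((x ∷ S) ≟S (a ∷ A)) ∧ c (x ∷ S)) subs
      ≡⟨ ⊕-sum-cong subs (λ S → trans (cong (_∧ c (x ∷ S)) (≟S-cons x a S A))
                                      (BP.∧-assoc ⌊ x BP.≟ a ⌋ (S ≟S A) (c (x ∷ S)))) ⟩
    ⊕-sum (λ S → ⌊ x BP.≟ a ⌋ ∧ ((S ≟S A) ∧ c (x ∷ S))) subs
      ≡⟨ ⊕-sum-scale ⌊ x BP.≟ a ⌋ (λ S → (S ≟S A) ∧ c (x ∷ S)) subs ⟩
    ⌊ x BP.≟ a ⌋ ∧ ⊕-sum (λ S → (S ≟S A) ∧ c (x ∷ S)) subs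
      ≡⟨ cong (⌊ x BP.≟ a ⌋ ∧_) (⊕-sum-δ n A (c ∘ (x ∷_))) ⟩
    ⌊ x BP.≟ a ⌋ ∧ c (x ∷ A) ∎

  by-head : ∀ a → (⌊ false BP.≟ a ⌋ ∧ c (false ∷ A)) xor (⌊ true BP.≟ a ⌋ ∧ c (true ∷ A)) ≡ c (a ∷ A)
  by-head false = xor-identityʳ (c (false ∷ A))
  by-head true  = refl

module _ {N : ℕ} where

  private
    subs : List (Subset N)
    subs = allSubs N

  *R-coeff : ∀ (f g : R N) U →
             (f *R g) U ≡ ⊕-sum (λ S → ⊕-sum (λ T → (f S ∧ g T) ∧ ((S ∪ T) ≟S U)) subs) subs
  *R-coeff f g U = xorSum-concatMap (λ S → map (λ T → (f S ∧ g T) ∧ ((S ∪ T) ≟S U)) subs) subs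

  expansion : ∀ (r : R N) U → r U ≡ ⊕-sum (λ S → r S ∧ mono S U) subs
  expansion r U = sym (trans (⊕-sum-cong subs swap) (⊕-sum-δ N U r))
    where
    swap : ∀ S → r S ∧ (U ≟S S) ≡ (S ≟S U) ∧ r S
    swap S = trans (∧-comm (r S) (U ≟S S)) (cong (_∧ r S) (≟S-sym U S))

  *R-distribˡ : ∀ (r a b : R N) → (r *R (a +R b)) ≈R ((r *R a) +R (r *R b))
  *R-distribˡ r a b U = begin
    (r *R (a +R b)) U
      ≡⟨ *R-coeff r (a +R b) U ⟩
    ⊕-sum (λ S → ⊕-sum (λ T → (r S ∧ (a T xor b T)) ∧ ((S ∪ T) ≟S U)) subs) subs
      ≡⟨ ⊕-sum-cong subs (λ S → ⊕-sum-cong subs (split-term S)) ⟩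
    ⊕-sum (λ S → ⊕-sum (λ T → term a S T xor term b S T) subs) subs
      ≡⟨ ⊕-sum-cong subs (λ S → ⊕-sum-xor (term a S) (term b S) subs) ⟩
    ⊕-sum (λ S → ⊕-sum (term a S) subs xor ⊕-sum (term b S) subs) subs
      ≡⟨ ⊕-sum-xor (λ S → ⊕-sum (term a S) subs) (λ S → ⊕-sum (term b S) subs) subs ⟩
    ⊕-sum (λ S → ⊕-sum (term a S) subs) subs xor ⊕-sum (λ S → ⊕-sum (term b S) subs) subs
      ≡⟨ sym (cong₂ _xor_ (*R-coeff r a U) (*R-coeff r b U)) ⟩
    ((r *R a) +R (r *R b)) U ∎
    where
    open ≡-Reasoning
    term : R N → Subset N → Subset N → Bool
    term c S T = (r S ∧ c T) ∧ ((S ∪ T) ≟S U)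
    split-term : ∀ S T → (r S ∧ (a T xor b T)) ∧ ((S ∪ T) ≟S U) ≡ term a S T xor term b S T
    split-term S T = trans (cong (_∧ ((S ∪ T) ≟S U)) (∧-distribˡ-xor (r S) (a T) (b T)))
                           (∧-distribʳ-xor ((S ∪ T) ≟S U) (r S ∧ a T) (r S ∧ b T))

  mono-*R-mono : ∀ (A B : Subset N) → (mono A *R mono B) ≈R mono (A ∪ B)
  mono-*R-mono A B U = begin
    (mono A *R mono B) U
      ≡⟨ *R-coeff (mono A) (mono B) U ⟩
    ⊕-sum (λ S → ⊕-sum (λ T → ((S ≟S A) ∧ (T ≟S B)) ∧ ((S ∪ T) ≟S U)) subs) subs
      ≡⟨ ⊕-sum-cong subs (λ S → trans (⊕-sum-cong subs (λ T → BP.∧-assoc (S ≟S A) (T ≟S B) _))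
                                      (⊕-sum-scale (S ≟S A) (λ T → (T ≟S B) ∧ ((S ∪ T) ≟S U)) subs)) ⟩
    ⊕-sum (λ S → (S ≟S A) ∧ ⊕-sum (λ T → (T ≟S B) ∧ ((S ∪ T) ≟S U)) subs) subs
      ≡⟨ ⊕-sum-δ N A (λ S → ⊕-sum (λ T → (T ≟S B) ∧ ((S ∪ T) ≟S U)) subs) ⟩
    ⊕-sum (λ T → (T ≟S B) ∧ ((A ∪ T) ≟S U)) subs
      ≡⟨ ⊕-sum-δ N B (λ T → (A ∪ T) ≟S U) ⟩
    (A ∪ B) ≟S U
      ≡⟨ ≟S-sym (A ∪ B) U ⟩
    mono (A ∪ B) U ∎
    where open ≡-Reasoning

  *R-support : ∀ (f g : R N) U → (f *R g) U ≡ true →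
               ∃₂ λ S T → f S ≡ true × g T ≡ true × S ∪ T ≡ U
  *R-support f g U fg≡1
    with S , inner≡1 ← ⊕-sum-true _ subs (trans (sym (*R-coeff f g U)) fg≡1)
    with T , term≡1  ← ⊕-sum-true _ subs inner≡1
    with fgST≡1 , S∪T≟U ← ∧-true term≡1
    with fS≡1 , gT≡1 ← ∧-true fgST≡1
    = S , T , fS≡1 , gT≡1 , ≟S-sound S∪T≟U

∣∪∣≤ : ∀ {n} (p q : Subset n) → ∣ p ∪ q ∣ ≤ ∣ p ∣ + ∣ q ∣
∣∪∣≤ []          []          = z≤n
∣∪∣≤ (true ∷ p)  (true ∷ q)  = s≤s (≤-trans (∣∪∣≤ p q) (+-monoʳ-≤ ∣ p ∣ (n≤1+n ∣ q ∣)))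
∣∪∣≤ (true ∷ p)  (false ∷ q) = s≤s (∣∪∣≤ p q)
∣∪∣≤ (false ∷ p) (true ∷ q)  = ≤-trans (s≤s (∣∪∣≤ p q)) (≤-reflexive (sym (+-suc ∣ p ∣ ∣ q ∣)))
∣∪∣≤ (false ∷ p) (false ∷ q) = ∣∪∣≤ p q

DegLe-mono : ∀ {N} (A : Subset N) → DegLe (mono A) ∣ A ∣
DegLe-mono A S S≟A = ≤-reflexive (cong ∣_∣ (≟S-sound S≟A))

DegLe-*R : ∀ {N} {f g : R N} {a b : ℕ} → DegLe f a → DegLe g b → DegLe (f *R g) (a + b)
DegLe-*R {f = f} {g} degf degg U fgU≡1
  with S , T , fS≡1 , gT≡1 , refl ← *R-support f g U fgU≡1
  = ≤-trans (∣∪∣≤ S T) (+-mono-≤ (degf S fS≡1) (degg T gT≡1))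

split : ∀ {n} k (S : Subset n) → k ≤ ∣ S ∣ →
        ∃₂ λ A I → A ∪ I ≡ S × ∣ I ∣ ≡ k × ∣ A ∣ + k ≡ ∣ S ∣
split zero    []          _  = [] , [] , refl , refl , refl
split k       (false ∷ S) k≤ with A , I , A∪I≡S , ∣I∣≡k , sizes ← split k S k≤
  = false ∷ A , false ∷ I , cong (false ∷_) A∪I≡S , ∣I∣≡k , sizes
split zero    (true ∷ S)  _  with A , I , A∪I≡S , ∣I∣≡0 , sizes ← split zero S z≤n
  = true ∷ A , false ∷ I , cong (true ∷_) A∪I≡S , ∣I∣≡0 , cong suc sizes
split (suc k) (true ∷ S) (s≤s k≤) with A , I , A∪I≡S , ∣I∣≡k , sizes ← split k S k≤
  = false ∷ A , true ∷ I , cong (true ∷_) A∪I≡S , cong suc ∣I∣≡k , trans (+-suc ∣ A ∣ k) (cong suc sizes)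

subsOf : (n j : ℕ) → List (Subset n)
subsOf zero    zero    = [] ∷ []
subsOf zero    (suc j) = []
subsOf (suc n) zero    = map (false ∷_) (subsOf n zero)
subsOf (suc n) (suc j) = map (false ∷_) (subsOf n (suc j)) ++ map (true ∷_) (subsOf n j)

-- Pascal's rule, read off from the two halves of the list.
length-subsOf : ∀ n j → length (subsOf n j) ≡ n C j
length-subsOf zero    zero    = refl
length-subsOf zero    (suc j) = refl
length-subsOf (suc n) zero    = trans (length-map (false ∷_) (subsOf n zero)) (length-subsOf n zero)
length-subsOf (suc n) (suc j) = begin
  length (map (false ∷_) (subsOf n (suc j)) ++ map (true ∷_) (subsOf n j))
    ≡⟨ length-++ (map (false ∷_) (subsOf n (suc j))) ⟩
  length (map (false ∷_) (subsOf n (suc j))) + length (map (true ∷_) (subsOf n j))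
    ≡⟨ cong₂ _+_ (trans (length-map (false ∷_) (subsOf n (suc j))) (length-subsOf n (suc j)))
                 (trans (length-map (true ∷_) (subsOf n j)) (length-subsOf n j)) ⟩
  n C suc j + n C j
    ≡⟨ +-comm (n C suc j) (n C j) ⟩
  n C j + n C suc j
    ≡⟨ nCk+nC[k+1]≡[n+1]C[k+1] n j ⟩
  suc n C suc j ∎
  where open ≡-Reasoning

∈-subsOf : ∀ {n} (S : Subset n) → S ∈ subsOf n ∣ S ∣
∈-subsOf []                  = here refl
∈-subsOf {suc n} (true ∷ S)  = ∈-++⁺ʳ (map (false ∷_) (subsOf n (suc ∣ S ∣))) (∈-map⁺ (true ∷_) (∈-subsOf S))
∈-subsOf {suc n} (false ∷ S) with ∣ S ∣ | ∈-subsOf S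
... | zero  | S∈ = ∈-map⁺ (false ∷_) S∈
... | suc j | S∈ = ∈-++⁺ˡ (∈-map⁺ (false ∷_) S∈)

length-concatMap : ∀ {A B : Set} (F : A → List B) (xs : List A) →
                   length (concatMap F xs) ≡ sum (map (length ∘ F) xs)
length-concatMap F []       = refl
length-concatMap F (x ∷ xs) = trans (length-++ (F x)) (cong (length (F x) +_) (length-concatMap F xs))

smallSubs : (N K : ℕ) → List (Subset N)
smallSubs N K = concatMap (subsOf N) (upTo K)

length-smallSubs : ∀ N K → length (smallSubs N K) ≡ binomSum N K
length-smallSubs N K =
  trans (length-concatMap (subsOf N) (upTo K)) (cong sum (map-cong (length-subsOf N) (upTo K)))

∈-smallSubs : ∀ {N K} (S : Subset N) → ∣ S ∣ < K → S ∈ smallSubs N K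
∈-smallSubs {N} S ∣S∣<K = ∈-concat⁺′ (∈-subsOf S) (∈-map⁺ (subsOf N) (∈-upTo⁺ ∣S∣<K))

enumerate : ∀ {A : Set} {m} (xs : List A) → length xs ≡ m → Fin m → A
enumerate xs len≡m i = lookup xs (subst Fin (sym len≡m) i)

enumerate-∈ : ∀ {A : Set} {m x} {xs : List A} (len≡m : length xs ≡ m) →
              x ∈ xs → ∃ λ i → enumerate xs len≡m i ≡ x
enumerate-∈ {xs = xs} len≡m x∈xs =
  subst Fin len≡m (index x∈xs) ,
  trans (cong (lookup xs) (subst-sym-subst len≡m)) (sym (lookup-index x∈xs))

linComb-xor : ∀ {N} m (c c′ : Fin m → Bool) (g : Fin m → R N) →
              linComb m (λ i → c i xor c′ i) g ≈R (linComb m c g +R linComb m c′ g)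
linComb-xor zero    c c′ g S = refl
linComb-xor (suc m) c c′ g S = begin
  ((c₀ xor c₀′) ∧ x) xor linComb m (λ i → c (Fin.suc i) xor c′ (Fin.suc i)) (g ∘ Fin.suc) S
    ≡⟨ cong₂ _xor_ (∧-distribʳ-xor x c₀ c₀′) (linComb-xor m (c ∘ Fin.suc) (c′ ∘ Fin.suc) (g ∘ Fin.suc) S) ⟩
  ((c₀ ∧ x) xor (c₀′ ∧ x)) xor (linComb m (c ∘ Fin.suc) (g ∘ Fin.suc) S xor linComb m (c′ ∘ Fin.suc) (g ∘ Fin.suc) S)
    ≡⟨ interchange (c₀ ∧ x) (c₀′ ∧ x) _ _ ⟩
  (linComb (suc m) c g +R linComb (suc m) c′ g) S ∎
  where
  open ≡-Reasoning
  c₀ = c Fin.zero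
  c₀′ = c′ Fin.zero
  x = g Fin.zero S

linComb-zero : ∀ {N} m (g : Fin m → R N) → linComb m (λ _ → false) g ≈R 0R
linComb-zero zero    g S = refl
linComb-zero (suc m) g S = linComb-zero m (g ∘ Fin.suc) S

unit : ∀ {m} → Fin m → Fin m → Bool
unit Fin.zero    Fin.zero    = true
unit Fin.zero    (Fin.suc _) = false
unit (Fin.suc _) Fin.zero    = false
unit (Fin.suc i) (Fin.suc j) = unit i j

linComb-unit : ∀ {N} m (g : Fin m → R N) i → linComb m (unit i) g ≈R g i
linComb-unit (suc m) g Fin.zero    S =
  trans (cong (g Fin.zero S xor_) (linComb-zero m (g ∘ Fin.suc) S)) (xor-identityʳ _)
linComb-unit (suc m) g (Fin.suc i) S = linComb-unit m (g ∘ Fin.suc) i S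

module Reduction {N : ℕ} (k : ℕ) (f : Subset N → R N) {m : ℕ} (g : Fin m → R N) where

  Reducible : R N → Set
  Reducible r = ∃ λ (c : Fin m → Bool) → InIdeal k f (r -R linComb m c g)

  reducible-resp : ∀ {r r′} → r ≈R r′ → Reducible r → Reducible r′
  reducible-resp r≈r′ (c , r-c∈J) = c , resp (λ S → cong (_xor linComb m c g S) (r≈r′ S)) r-c∈J

  reducible-zero : Reducible 0R
  reducible-zero = (λ _ → false) , resp (λ S → sym (linComb-zero m g S)) zro

  reducible-+ : ∀ {a b} → Reducible a → Reducible b → Reducible (a +R b)
  reducible-+ {a} {b} (c , a-c∈J) (c′ , b-c′∈J) =
    (λ i → c i xor c′ i) , resp regroup (add a-c∈J b-c′∈J)
    where
    regroup : ((a -R linComb m c g) +R (b -R linComb m c′ g)) ≈R ((a +R b) -R linComb m (λ i → c i xor c′ i) g)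
    regroup S = trans (interchange (a S) (linComb m c g S) (b S) (linComb m c′ g S))
                      (cong ((a S xor b S) xor_) (sym (linComb-xor m c c′ g S)))

  reducible-+ideal : ∀ {j r} → InIdeal k f j → Reducible r → Reducible (j +R r)
  reducible-+ideal {j} {r} j∈J (c , r-c∈J) =
    c , resp (λ S → sym (xor-assoc (j S) (r S) (linComb m c g S))) (add j∈J r-c∈J)

  reducible-member : ∀ i → Reducible (g i)
  reducible-member i = unit i , resp (λ S → sym (cancel S)) zro
    where
    cancel : ∀ S → g i S xor linComb m (unit i) g S ≡ false
    cancel S = trans (cong (g i S xor_) (linComb-unit m g i S)) (xor-same (g i S))

  reducible-by-support : ∀ r → (∀ S → r S ≡ true → Reducible (mono S)) → Reducible r
  reducible-by-support r mono-red =
    reducible-resp (λ U → sym (expansion r U)) (partial-sums (allSubs N))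
    where
    term : Subset N → R N
    term S = r S ·R mono S

    reducible-term : ∀ S → Reducible (term S)
    reducible-term S with r S in rS
    ... | true  = mono-red S rS
    ... | false = reducible-zero

    partial-sums : ∀ Ss → Reducible (λ U → ⊕-sum (λ S → term S U) Ss)
    partial-sums []       = reducible-zero
    partial-sums (S ∷ Ss) = reducible-+ {term S} (reducible-term S) (partial-sums Ss)

smallMonomials : (N K : ℕ) → Fin (binomSum N K) → R N
smallMonomials N K = mono ∘ enumerate (smallSubs N K) (length-smallSubs N K)

module MonomialReduction {N k : ℕ} (f : Subset N → R N)
                         (deg : ∀ I → ∣ I ∣ ≡ suc k → DegLe (f I -R mono I) k) where

  open Reduction (suc k) f (smallMonomials N (suc k))

  small-reducible : ∀ S → ∣ S ∣ < suc k → Reducible (mono S)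
  small-reducible S ∣S∣<K with i , gᵢ≡S ← enumerate-∈ (length-smallSubs N (suc k)) (∈-smallSubs S ∣S∣<K)
    = reducible-resp (λ U → cong (λ T → mono T U) gᵢ≡S) (reducible-member i)

  split-monomial : ∀ A I → mono (A ∪ I) ≈R ((mono A *R f I) +R (mono A *R (f I -R mono I)))
  split-monomial A I U = begin
    mono (A ∪ I) U
      ≡⟨ sym (mono-*R-mono A I U) ⟩
    (mono A *R mono I) U
      ≡⟨ sym (xor-cancel ((mono A *R f I) U) _) ⟩
    (mono A *R f I) U xor ((mono A *R f I) U xor (mono A *R mono I) U)
      ≡⟨ cong ((mono A *R f I) U xor_) (sym (*R-distribˡ (mono A) (f I) (mono I) U)) ⟩
    ((mono A *R f I) +R (mono A *R (f I -R mono I))) U ∎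
    where open ≡-Reasoning

  correction-degree : ∀ A I → ∣ I ∣ ≡ suc k →
                      DegLe (mono A *R (f I -R mono I)) (∣ A ∣ + k)
  correction-degree A I ∣I∣≡K = DegLe-*R (DegLe-mono A) (deg I ∣I∣≡K)

  large-reducible : ∀ S → suc k ≤ ∣ S ∣ → (∀ U → ∣ U ∣ < ∣ S ∣ → Reducible (mono U)) →
                    Reducible (mono S)
  large-reducible S K≤∣S∣ smaller-reducible
    with A , I , refl , ∣I∣≡K , sizes ← split (suc k) S K≤∣S∣
    = reducible-resp (λ U → sym (split-monomial A I U))
        (reducible-+ideal (mul (mono A) (gen I ∣I∣≡K))
          (reducible-by-support (mono A *R (f I -R mono I))
            (λ U inSupport → smaller-reducible U
              (subst (∣ U ∣ <_) sizes
                (≤-<-trans (correction-degree A I ∣I∣≡K U inSupport) (+-monoʳ-< ∣ A ∣ (n<1+n k)))))))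

  monomial-reducible : ∀ S → Reducible (mono S)
  monomial-reducible S = <-rec Claim step ∣ S ∣ S refl
    where
    Claim : ℕ → Set
    Claim d = ∀ S → ∣ S ∣ ≡ d → Reducible (mono S)

    step : ∀ d → (∀ {d′} → d′ < d → Claim d′) → Claim d
    step _ smaller S refl with ∣ S ∣ <? suc k
    ... | yes ∣S∣<K = small-reducible S ∣S∣<K
    ... | no  ∣S∣≮K = large-reducible S (≮⇒≥ ∣S∣≮K) (λ U ∣U∣<∣S∣ → smaller ∣U∣<∣S∣ U refl)

lemma2p11 : (N k : ℕ) → 1 ≤ k → k ≤ N → (f : Subset N → R N) →
    (∀ I → ∣ I ∣ ≡ k → DegLe (f I -R mono I) (k ∸ 1)) →
    QuotDimLe (InIdeal k f) (binomSum N k)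
lemma2p11 N zero    ()  _ _ _
lemma2p11 N (suc k) _   _ f deg =
  smallMonomials N (suc k) , λ r → reducible-by-support r (λ S _ → monomial-reducible S)
  where
  open MonomialReduction f deg
  open Reduction (suc k) f (smallMonomials N (suc k))
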